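{- Let $(X,\tau)$ be a scattered topological space. Then $X$ validates the formula $\Box(\Box^+p\vee\Box^+q)\to\Box p\vee\Box q$ (where $\Box^+\varphi:=\varphi\wedge\Box\varphi$) under the topological derivative semantics if and only if $X$ is primal.
   Context: A topological space is scattered if every nonempty subset has an isolated point (in the relative topology). For $A\subseteq X$, $d_\tau(A)$ is the set of limit points of $A$: $x\in d_\tau(A)$ iff every open $U\ni x$ contains some $y\neq x$ with $y\in A$. Derivative semantics: a valuation $v$ maps formulas to subsets of $X$ with $v(\phi\vee\psi)=v(\phi)\cup v(\psi)$, $v(\neg\phi)=X\setminus v(\phi)$, $v(\top)=X$, $v(\bot)=\emptyset$, $v(\Diamond\phi)=d_\tau(v(\phi))$, and $\Box=\neg\Diamond\neg$; $X$ validates $\phi$ if $v(\phi)=X$ for every valuation $v$. A scattered space $(X,\tau)$ is called primal if for each $x\in X$ and all $U,V\in\tau$, if $\{x\}\cup U\cup V\in\tau$ then $\{x\}\cup U\in\tau$ or $\{x\}\cup V\in\tau$. -}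

module Defs where

open import Level using (Level; 0ℓ; _⊔_; Lift; lift) renaming (suc to lsuc)
open import Data.Nat using (ℕ)
open import Data.Product using (Σ; ∃; _×_; _,_)
open import Data.Sum using (_⊎_)
open import Data.Unit.Polymorphic using (⊤)
open import Data.Empty.Polymorphic using (⊥)
open import Relation.Nullary using (¬_)
open import Relation.Binary.PropositionalEquality using (_≡_; _≢_)
open import Relation.Unary using (Pred; _∪_; _∩_; ∁; _≐_)

Subset : Set → Set₁
Subset X = Pred X 0ℓ

-- Unions are taken over
-- families indexed by arbitrary types in Set₁ (large enough to index families
-- of subsets of X).
record Topology (X : Set) : Set₂ where
  field
    Open      : Subset X → Set₁
    open-resp : ∀ {U V : Subset X} → U ≐ V → Open U → Open V
    open-univ : Open (λ _ → ⊤)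
    open-∩    : ∀ {U V : Subset X} → Open U → Open V → Open (U ∩ V)
    open-⋃    : ∀ {I : Set₁} (F : I → Subset X) → (∀ i → Open (F i)) →
                (W : Subset X) →
                (∀ x → (W x → ∃ λ i → F i x) × ((∃ λ i → F i x) → W x)) →
                Open W

module _ {X : Set} (τ : Topology X) where
  open Topology τ

  ⟨_⟩ : X → Subset X
  ⟨ x ⟩ = λ y → y ≡ x

  d : ∀ {a} → Pred X a → Pred X (lsuc 0ℓ ⊔ a)
  d A x = ∀ (U : Subset X) → Open U → U x → ∃ λ y → y ≢ x × U y × A y

  IsIsolatedIn : Subset X → X → Set₁
  IsIsolatedIn A x = A x × Σ (Subset X) λ U → Open U × U x ×
                       (∀ y → U y → A y → y ≡ x)

  Scattered : Set₁
  Scattered = ∀ (A : Subset X) → (∃ λ x → A x) → ∃ λ x → IsIsolatedIn A x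

  Primal : Set₁
  Primal = Scattered ×
    (∀ (x : X) (U V : Subset X) → Open U → Open V →
       Open ((⟨ x ⟩ ∪ U) ∪ V) → Open (⟨ x ⟩ ∪ U) ⊎ Open (⟨ x ⟩ ∪ V))

data Fm : Set where
  var  : ℕ → Fm
  ⊤'   : Fm
  ⊥'   : Fm
  ¬'_  : Fm → Fm
  _∨'_ : Fm → Fm → Fm
  ◇_   : Fm → Fm

infixr 6 _∧'_
infixr 5 _∨'_
infixr 4 _⇒'_
infix 8 ¬'_ ◇_ □_ □⁺_

_∧'_ : Fm → Fm → Fm
φ ∧' ψ = ¬' (¬' φ ∨' ¬' ψ)

_⇒'_ : Fm → Fm → Fm
φ ⇒' ψ = ¬' φ ∨' ψ

□_ : Fm → Fm
□ φ = ¬' (◇ (¬' φ))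

□⁺_ : Fm → Fm
□⁺ φ = φ ∧' □ φ

Valuation : Set → Set₁
Valuation X = ℕ → Subset X

module _ {X : Set} (τ : Topology X) where
  ⟦_⟧ : Fm → Valuation X → Pred X (lsuc 0ℓ)
  ⟦ var n ⟧   v = λ x → Lift (lsuc 0ℓ) (v n x)
  ⟦ ⊤' ⟧      v = λ _ → ⊤
  ⟦ ⊥' ⟧      v = λ _ → ⊥
  ⟦ ¬' φ ⟧    v = ∁ (⟦ φ ⟧ v)
  ⟦ φ ∨' ψ ⟧  v = ⟦ φ ⟧ v ∪ ⟦ ψ ⟧ v
  ⟦ ◇ φ ⟧     v = d τ (⟦ φ ⟧ v)

  Validates : Fm → Set₁
  Validates φ = ∀ (v : Valuation X) (x : X) → ⟦ φ ⟧ v x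

pVar qVar : Fm
pVar = var 0
qVar = var 1

primalFormula : Fm
primalFormula = □ (□⁺ pVar ∨' □⁺ qVar) ⇒' (□ pVar ∨' □ qVar)

-- Classically, the derivative semantics of the boxes has a neighbourhood
-- reading, which is all the argument uses:
--   * □A holds at x  iff  some open W ∋ x has W ∖ {x} ⊆ A  (a punctured
--     neighbourhood of x inside A);
--   * □⁺A holds at y  iff  y lies in the interior of A;
--   * for open U,  {x} ∪ U is open  iff  x has a punctured neighbourhood in U.
-- Primal ⇒ valid: if □(□⁺p ∨ □⁺q) holds at x with witness W, then W is
-- {x} ∪ (W ∩ int p) ∪ (W ∩ int q); primality makes {x} ∪ (W ∩ int p) (say)
-- open, which is a punctured neighbourhood of x inside p, i.e. □p at x.
-- Valid ⇒ primal: given opens U, V with {x} ∪ U ∪ V open, evaluate the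
-- formula at x with p := U, q := V; the antecedent holds, and □p (say) makes
-- {x} ∪ U open.  Scatteredness is only carried along (it is part of Primal).
module Submission where

open import Defs
open import Level using (Level; 0ℓ; _⊔_; Lift; lift; lower) renaming (suc to lsuc)
open import Axiom.ExcludedMiddle using (ExcludedMiddle)
open import Axiom.DoubleNegationElimination using (DoubleNegationElimination; em⇒dne)
open import Function.Bundles using (_⇔_; mk⇔)
open import Data.Product using (Σ; _×_; _,_; proj₁; proj₂)
open import Data.Sum using (_⊎_; inj₁; inj₂; [_,_])
import Data.Sum as Sum
open import Data.Bool using (Bool; true; false)
open import Data.Nat using (zero; suc)
open import Data.Empty using (⊥-elim)
open import Relation.Nullary using (¬_; Dec; yes; no)
open import Relation.Nullary.Decidable using (True; toWitness; fromWitness)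
open import Relation.Binary.PropositionalEquality using (_≡_; _≢_; refl)
open import Relation.Unary using (Pred; _∪_; _∩_; ∁; _≐_; _⊆_)
open import Relation.Unary.Properties using (≐-sym)

module Classical (em : ∀ {ℓ : Level} → ExcludedMiddle ℓ) {X : Set} (τ : Topology X) where
  open Topology τ

  private
    variable
      a b : Level

  dne : ∀ {ℓ} → DoubleNegationElimination ℓ
  dne = em⇒dne em

  _≟_ : (y x : X) → Dec (y ≡ x)
  y ≟ x = em

  singleton : X → Subset X
  singleton = ⟨_⟩ τ

  open-∪ : {U V : Subset X} → Open U → Open V → Open (U ∪ V)
  open-∪ {U} {V} oU oV =
    open-⋃ {I = Lift _ Bool} family (λ { (lift true) → oU ; (lift false) → oV }) (U ∪ V)
      (λ y → [ (λ Uy → lift true , Uy) , (λ Vy → lift false , Vy) ]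
           , (λ { (lift true , Uy) → inj₁ Uy ; (lift false , Vy) → inj₂ Vy }))
    where
    family : Lift _ Bool → Subset X
    family (lift true)  = U
    family (lift false) = V

  Nbhd : Pred X a → X → Set (lsuc 0ℓ ⊔ a)
  Nbhd A x = Σ (Subset X) λ U → Open U × U x × U ⊆ A

  PuncturedNbhd : Pred X a → X → Set (lsuc 0ℓ ⊔ a)
  PuncturedNbhd A x = Σ (Subset X) λ W → Open W × W x × (∀ {y} → W y → y ≢ x → A y)

  punctured-mono : {A : Pred X a} {B : Pred X b} {x : X} →
                   A ⊆ B → PuncturedNbhd A x → PuncturedNbhd B x
  punctured-mono A⊆B (W , oW , Wx , sub) = W , oW , Wx , λ Wy y≢x → A⊆B (sub Wy y≢x)

  fill-point : {A : Pred X a} {x : X} → A x → PuncturedNbhd A x → Nbhd A x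
  fill-point {x = x} Ax (W , oW , Wx , sub) = W , oW , Wx , inside
    where
    inside : W ⊆ _
    inside {y} Wy with y ≟ x
    ... | yes refl = Ax
    ... | no y≢x   = sub Wy y≢x

  -- The interior of A, squashed (via excluded middle) to a small subset.
  -- Unions are indexed by Set₁, so A lives at the level of the semantics.
  Int : Pred X (lsuc 0ℓ) → Subset X
  Int A y = True (em {P = Nbhd A y})

  Int-open : (A : Pred X (lsuc 0ℓ)) → Open (Int A)
  Int-open A = open-⋃ {I = Σ (Subset X) λ U → Open U × U ⊆ A} proj₁ (λ i → proj₁ (proj₂ i)) (Int A)
    (λ y → (λ iy → let (U , oU , Uy , U⊆A) = toWitness iy in (U , oU , λ {z} → U⊆A {z}) , Uy)
         , (λ { ((U , oU , U⊆A) , Uy) → fromWitness (U , oU , Uy , λ {z} → U⊆A {z}) }))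

  Int-sub : (A : Pred X (lsuc 0ℓ)) → Int A ⊆ A
  Int-sub A iy = let (_ , _ , Uy , U⊆A) = toWitness iy in U⊆A Uy

  Nbhd⇒Int : {A : Pred X (lsuc 0ℓ)} {y : X} → Nbhd A y → Int A y
  Nbhd⇒Int = fromWitness

  point-union-punctured : {U : Subset X} {x : X} → Open (singleton x ∪ U) → PuncturedNbhd U x
  point-union-punctured o = _ , o , inj₁ refl , λ { (inj₁ y≡x) y≢x → ⊥-elim (y≢x y≡x)
                                                  ; (inj₂ Uy) _   → Uy }

  point-union-open : {U : Subset X} {x : X} → Open U → PuncturedNbhd U x → Open (singleton x ∪ U)
  point-union-open {U} {x} oU (W , oW , Wx , sub) = open-resp W∪U≐ (open-∪ oW oU)
    where
    W∪U≐ : (W ∪ U) ≐ (singleton x ∪ U)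
    W∪U≐ = [ from-W , inj₂ ] , [ (λ { refl → inj₁ Wx }) , inj₂ ]
      where
      from-W : W ⊆ singleton x ∪ U
      from-W {y} Wy with y ≟ x
      ... | yes y≡x = inj₁ y≡x
      ... | no y≢x  = inj₂ (sub Wy y≢x)

  split-around : {W A B : Subset X} {x : X} → W x → (∀ {y} → W y → y ≢ x → A y ⊎ B y) →
                 ((singleton x ∪ (W ∩ A)) ∪ (W ∩ B)) ≐ W
  split-around {W} {A} {B} {x} Wx cover =
      (λ { (inj₁ (inj₁ refl)) → Wx ; (inj₁ (inj₂ (Wy , _))) → Wy ; (inj₂ (Wy , _)) → Wy })
    , pieces
    where
    pieces : W ⊆ (singleton x ∪ (W ∩ A)) ∪ (W ∩ B)
    pieces {y} Wy with y ≟ x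
    ... | yes y≡x = inj₁ (inj₁ y≡x)
    ... | no y≢x  = Sum.map (λ Ay → inj₂ (Wy , Ay)) (λ By → (Wy , By)) (cover Wy y≢x)

  -- Neighbourhood reading of □ : ⟦ □ φ ⟧ v x  is  ¬ d τ (∁ (⟦ φ ⟧ v)) x.
  □-intro : {A : Pred X a} {x : X} → PuncturedNbhd A x → ¬ d τ (∁ A) x
  □-intro (W , oW , Wx , sub) limit =
    let (_ , y≢x , Wy , ¬Ay) = limit W oW Wx in ¬Ay (sub Wy y≢x)

  □-elim : {A : Pred X a} {x : X} → ¬ d τ (∁ A) x → PuncturedNbhd A x
  □-elim ¬limit = dne λ ¬nbhd → ¬limit λ U oU Ux → dne λ ¬witness →
    ¬nbhd (U , oU , Ux , λ {y} Uy y≢x → dne λ ¬Ay → ¬witness (y , y≢x , Uy , ¬Ay))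

  □⁺-intro : (φ : Fm) (v : Valuation X) {y : X} → Nbhd (⟦_⟧ τ φ v) y → ⟦_⟧ τ (□⁺ φ) v y
  □⁺-intro φ v (U , oU , Uy , U⊆A) =
    [ (λ ¬Ay → ¬Ay (U⊆A Uy)) , (λ ¬□A → ¬□A (□-intro (U , oU , Uy , λ Uz _ → U⊆A Uz))) ]

  □⁺-elim : (φ : Fm) (v : Valuation X) {y : X} → ⟦_⟧ τ (□⁺ φ) v y → Nbhd (⟦_⟧ τ φ v) y
  □⁺-elim φ v h = fill-point (dne (λ ¬Ay → h (inj₁ ¬Ay))) (□-elim (dne (λ ¬□A → h (inj₂ ¬□A))))

  -- Core of primal ⇒ valid: if W ∖ {x} lies in int A ∪ int B, then W is
  -- {x} ∪ (W ∩ int A) ∪ (W ∩ int B), and primality turns this into a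
  -- punctured neighbourhood of x inside A or inside B.
  primal-split : Primal τ → {A B : Pred X (lsuc 0ℓ)} {x : X} →
                 PuncturedNbhd (λ y → Nbhd A y ⊎ Nbhd B y) x → PuncturedNbhd A x ⊎ PuncturedNbhd B x
  primal-split (_ , primal) {A} {B} {x} (W , oW , Wx , cover) =
    Sum.map (from-part A) (from-part B)
      (primal x (W ∩ Int A) (W ∩ Int B) (open-∩ oW (Int-open A)) (open-∩ oW (Int-open B)) split-open)
    where
    split-open : Open ((singleton x ∪ (W ∩ Int A)) ∪ (W ∩ Int B))
    split-open = open-resp (≐-sym (split-around Wx λ Wy y≢x → Sum.map Nbhd⇒Int Nbhd⇒Int (cover Wy y≢x))) oW

    from-part : (C : Pred X (lsuc 0ℓ)) → Open (singleton x ∪ (W ∩ Int C)) → PuncturedNbhd C x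
    from-part C o = punctured-mono (λ py → Int-sub C (proj₂ py)) (point-union-punctured o)

  primal⇒valid : Primal τ → Validates τ primalFormula
  primal⇒valid primal v x with em {P = ⟦_⟧ τ (□ (□⁺ pVar ∨' □⁺ qVar)) v x}
  ... | no ¬antecedent = inj₁ ¬antecedent
  ... | yes antecedent = inj₂ (Sum.map □-intro □-intro (primal-split primal interiors))
    where
    interiors : PuncturedNbhd (λ y → Nbhd (⟦_⟧ τ pVar v) y ⊎ Nbhd (⟦_⟧ τ qVar v) y) x
    interiors = punctured-mono (Sum.map (□⁺-elim pVar v) (□⁺-elim qVar v)) (□-elim antecedent)

  interpret : Subset X → Subset X → Valuation X
  interpret U V zero    = U
  interpret U V (suc _) = V

  valid⇒primal : Scattered τ → Validates τ primalFormula → Primal τ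
  valid⇒primal scattered valid = scattered , primal
    where
    primal : ∀ (x : X) (U V : Subset X) → Open U → Open V →
             Open ((singleton x ∪ U) ∪ V) → Open (singleton x ∪ U) ⊎ Open (singleton x ∪ V)
    primal x U V oU oV oW with valid (interpret U V) x
    ... | inj₁ ¬antecedent = ⊥-elim (¬antecedent antecedent)
      where
      v = interpret U V
      antecedent : ⟦_⟧ τ (□ (□⁺ pVar ∨' □⁺ qVar)) v x
      antecedent = □-intro (_ , oW , inj₁ (inj₁ refl) ,
        λ { (inj₁ (inj₁ y≡x)) y≢x → ⊥-elim (y≢x y≡x)
          ; (inj₁ (inj₂ Uy)) _ → inj₁ (□⁺-intro pVar v (U , oU , Uy , lift))
          ; (inj₂ Vy) _        → inj₂ (□⁺-intro qVar v (V , oV , Vy , lift)) })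
    ... | inj₂ (inj₁ □p) = inj₁ (point-union-open oU (punctured-mono lower (□-elim □p)))
    ... | inj₂ (inj₂ □q) = inj₂ (point-union-open oV (punctured-mono lower (□-elim □q)))

mainTheorem2 : (em : ∀ {ℓ : Level} → ExcludedMiddle ℓ) →
    (X : Set) (τ : Topology X) → Scattered τ →
      (Validates τ primalFormula ⇔ Primal τ)
mainTheorem2 em X τ scattered = mk⇔ (valid⇒primal scattered) primal⇒valid
  where open Classical em τ
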